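{- Let $\mathcal{M}=\langle M,\sqsubseteq^{\mathcal{M}}\rangle$ be a model of $\mathrm{IABA}$, let $A$ be its set of atoms, let $I\subseteq M$ be a proper ideal of $\mathcal{M}$ with $A\subseteq I$, and let $f:I\to A$ be a bijection. Define $\in^*\subseteq M\times M$ by $x\in^* y$ iff $x\in I$ and $f(x)\sqsubseteq^{\mathcal{M}}y$. Then $\langle M,I,\in^*\rangle\models\mathrm{BAC}$ and the subset relation $\subseteq^{\langle M,I,\in^*\rangle}$ equals $\sqsubseteq^{\mathcal{M}}$.
   Context: $\mathrm{IABA}$ is the theory of infinite atomic Boolean algebras in the language $\{\sqsubseteq\}$: $\sqsubseteq$ is a distributive complemented lattice order with least element $0$ and greatest element $1$, every nonzero element has an atom (a nonzero $a$ whose only lower elements are $0$ and $a$) below it, and there are infinitely many atoms. A proper ideal $I$ is a set with $0\in I$, $1\notin I$, closed under binary joins and downward closed. $\mathcal{L}_{cl}$ is the language with binary $\in$ and unary $\mathcal{S}$; in a structure $\langle N,\mathcal{S}^{\mathcal{N}},\in^{\mathcal{N}}\rangle$ elements of $\mathcal{S}^{\mathcal{N}}$ are sets and all elements are classes (lowercase variables range over sets, uppercase over classes). $\mathrm{BAC}$ has axioms: (Mem) if $X\in Y$ then $X$ is a set; (Subset) if $x$ is a set and every set in $X$ is in $x$ then $X$ is a set; (Emp) there is a set with no set members; (Adj) for sets $x,y$ there is a set $z$ with set members exactly those of $x$ together with $y$; (CExt) classes with the same set members are equal; (Union) for sets $x,y$ there is a set whose set members are those in $x$ or $y$; (UB)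 for every set $x$ there is a set $y\notin x$; (CUnion),(CIntersection) classes are closed under union and intersection (of set members); (CComp) every class $X$ has a class whose set members are exactly the sets not in $X$. The subset relation of the structure: $X\subseteq Y$ iff every set member of $X$ is a member of $Y$. -}

module Defs where

open import Data.Nat using (ℕ)
open import Data.Fin using (Fin)
open import Data.Product using (Σ; _×_)
open import Data.Sum using (_⊎_)
open import Relation.Nullary using (¬_)
open import Relation.Binary.PropositionalEquality using (_≡_; _≢_)
open import Function.Bundles using (_⇔_)

module Order {M : Set} (_⊑_ : M → M → Set) where

  IsJoin : M → M → M → Set
  IsJoin x y z = (x ⊑ z) × (y ⊑ z) × (∀ w → x ⊑ w → y ⊑ w → z ⊑ w)

  IsMeet : M → M → M → Set
  IsMeet x y z = (z ⊑ x) × (z ⊑ y) × (∀ w → w ⊑ x → w ⊑ y → w ⊑ z)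

  IsLeast : M → Set
  IsLeast b = ∀ x → b ⊑ x

  IsGreatest : M → Set
  IsGreatest t = ∀ x → x ⊑ t

-- Models of IABA: infinite atomic Boolean algebras, axiomatised in the
-- language {⊑} (⊑ a distributive complemented bounded lattice order,
-- atomic, with infinitely many atoms).

record IABA (M : Set) (_⊑_ : M → M → Set) : Set where
  open Order _⊑_ public
  field
    ⊑-refl    : ∀ x → x ⊑ x
    ⊑-trans   : ∀ x y z → x ⊑ y → y ⊑ z → x ⊑ z
    ⊑-antisym : ∀ x y → x ⊑ y → y ⊑ x → x ≡ y
    join      : ∀ x y → Σ M (IsJoin x y)
    meet      : ∀ x y → Σ M (IsMeet x y)
    𝟘         : M
    𝟘-least   : IsLeast 𝟘
    𝟙         : M
    𝟙-greatest : IsGreatest 𝟙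
    -- distributivity: x ∧ (y ∨ z) = (x ∧ y) ∨ (x ∧ z)
    distrib   : ∀ x y z j m a b c →
                IsJoin y z j → IsMeet x j m →
                IsMeet x y a → IsMeet x z b → IsJoin a b c → m ≡ c

  Atom : M → Set
  Atom a = (a ≢ 𝟘) × (∀ y → y ⊑ a → (y ≡ 𝟘) ⊎ (y ≡ a))

  field
    complemented : ∀ x → Σ M (λ y → IsMeet x y 𝟘 × IsJoin x y 𝟙)
    atomic       : ∀ x → x ≢ 𝟘 → Σ M (λ a → Atom a × (a ⊑ x))
    infinite     : ∀ (n : ℕ) → Σ (Fin n → M) (λ g →
                     (∀ i → Atom (g i)) × (∀ i j → g i ≡ g j → i ≡ j))

  record ProperIdeal (I : M → Set) : Set where
    field
      𝟘∈I     : I 𝟘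
      𝟙∉I     : ¬ I 𝟙
      join-closed : ∀ x y z → I x → I y → IsJoin x y z → I z
      down-closed : ∀ x y → y ⊑ x → I x → I y

-- Structures ⟨N, S, ∈⟩ for the language L_cl and the theory BAC.
-- S X : "X is a set";  E X Y : "X ∈ Y".

module Classes {N : Set} (S : N → Set) (E : N → N → Set) where

  _⊆_ : N → N → Set
  X ⊆ Y = ∀ z → S z → E z X → E z Y

  record BAC : Set where
    field
      Mem     : ∀ X Y → E X Y → S X
      Subset  : ∀ x X → S x → (∀ y → S y → E y X → E y x) → S X
      Emp     : Σ N (λ x → S x × (∀ y → S y → ¬ E y x))
      Adj     : ∀ x y → S x → S y → Σ N (λ z → S z ×
                  (∀ w → S w → (E w z ⇔ (E w x ⊎ w ≡ y))))
      CExt    : ∀ X Y → (∀ z → S z → (E z X ⇔ E z Y)) → X ≡ Y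
      Union   : ∀ x y → S x → S y → Σ N (λ z → S z ×
                  (∀ w → S w → (E w z ⇔ (E w x ⊎ E w y))))
      UB      : ∀ x → S x → Σ N (λ y → S y × ¬ E y x)
      CUnion  : ∀ X Y → Σ N (λ Z →
                  ∀ w → S w → (E w Z ⇔ (E w X ⊎ E w Y)))
      CIntersection : ∀ X Y → Σ N (λ Z →
                  ∀ w → S w → (E w Z ⇔ (E w X × E w Y)))
      CComp   : ∀ X → Σ N (λ Y → ∀ w → S w → (E w Y ⇔ (¬ E w X)))

-- An element of an atomic Boolean algebra is determined, classically, by the atoms below
-- it, and f identifies I with the atoms, so x ∈* X reads "the atom coding x lies below X".
-- Hence ⊆* is ⊑, which gives CExt and Subset (I is downward closed).  Since an atom is
-- join-prime, joins, meets and complements, read through the atoms, are unions,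
-- intersections and complements; adjoining y is joining with the atom f y; and as 1 ∉ I,
-- the complement of a set contains an atom, which codes a set outside it.
module Submission where

open import Defs
open import Data.Product using (Σ; _×_; _,_; proj₁; proj₂)
open import Data.Sum using (_⊎_; inj₁; inj₂)
open import Data.Empty using (⊥-elim)
open import Relation.Nullary using (¬_; yes; no)
open import Relation.Binary.PropositionalEquality using (_≡_; refl; sym; subst)
open import Function.Bundles using (_⇔_; mk⇔; Equivalence)
open import Function.Construct.Composition using (_⇔-∘_)
open import Function.Construct.Identity using (⇔-id)
open import Data.Sum.Function.Propositional using (_⊎-⇔_)
open import Axiom.ExcludedMiddle using (ExcludedMiddle)
open import Level using (0ℓ)

module AtomicBooleanAlgebra {M : Set} {_⊑_ : M → M → Set} (𝓜 : IABA M _⊑_) where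

  open IABA 𝓜

  ⊑-trans′ : ∀ {x y z} → x ⊑ y → y ⊑ z → x ⊑ z
  ⊑-trans′ {x} {y} {z} = ⊑-trans x y z

  ⊑𝟘⇒≡𝟘 : ∀ {x} → x ⊑ 𝟘 → x ≡ 𝟘
  ⊑𝟘⇒≡𝟘 {x} x⊑𝟘 = ⊑-antisym x 𝟘 x⊑𝟘 (𝟘-least x)

  atom⋢𝟘 : ∀ {a} → Atom a → ¬ a ⊑ 𝟘
  atom⋢𝟘 (a≢𝟘 , _) a⊑𝟘 = a≢𝟘 (⊑𝟘⇒≡𝟘 a⊑𝟘)

  atom⊑atom⇒≡ : ∀ {a b} → Atom a → Atom b → a ⊑ b → a ≡ b
  atom⊑atom⇒≡ (a≢𝟘 , _) (_ , below-b) a⊑b with below-b _ a⊑b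
  ... | inj₁ a≡𝟘 = ⊥-elim (a≢𝟘 a≡𝟘)
  ... | inj₂ a≡b = a≡b

  atom-meet≡𝟘⊎⊑ : ∀ {a x m} → Atom a → IsMeet a x m → m ≡ 𝟘 ⊎ a ⊑ x
  atom-meet≡𝟘⊎⊑ {x = x} (_ , below-a) (m⊑a , m⊑x , _) with below-a _ m⊑a
  ... | inj₁ m≡𝟘 = inj₁ m≡𝟘
  ... | inj₂ m≡a = inj₂ (subst (_⊑ x) m≡a m⊑x)

  -- If a ∧ x = 0 then, by distributivity, a = a ∧ (x ∨ y) = (a ∧ x) ∨ (a ∧ y) ⊑ y.
  atom⊑join : ∀ {a x y j} → Atom a → IsJoin x y j → a ⊑ j → a ⊑ x ⊎ a ⊑ y
  atom⊑join {a} {x} {y} {j} atom-a x∨y a⊑j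
    with meet a x | meet a y | meet a j
  ... | m₁ , a∧x | m₂ , a∧y@(_ , m₂⊑y , _) | m , a∧j@(_ , _ , a∧j-greatest)
    with atom-meet≡𝟘⊎⊑ atom-a a∧x
  ... | inj₂ a⊑x = inj₁ a⊑x
  ... | inj₁ m₁≡𝟘 = inj₂ (⊑-trans′ a⊑c c⊑y)
    where
    c : M
    c = proj₁ (join m₁ m₂)
    m₁∨m₂ : IsJoin m₁ m₂ c
    m₁∨m₂ = proj₂ (join m₁ m₂)
    a⊑c : a ⊑ c
    a⊑c = subst (a ⊑_) (distrib a x y j m m₁ m₂ c x∨y a∧j a∧x a∧y m₁∨m₂)
                (a∧j-greatest a (⊑-refl a) a⊑j)
    c⊑y : c ⊑ y
    c⊑y = proj₂ (proj₂ m₁∨m₂) y (subst (_⊑ y) (sym m₁≡𝟘) (𝟘-least y)) m₂⊑y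

  atom⊑⊎⊑complement : ∀ {a x c} → Atom a → IsJoin x c 𝟙 → a ⊑ x ⊎ a ⊑ c
  atom⊑⊎⊑complement {a} atom-a x∨c = atom⊑join atom-a x∨c (𝟙-greatest a)

  ⊑complement⇒⋢ : ∀ {a x c} → Atom a → IsMeet x c 𝟘 → a ⊑ c → ¬ a ⊑ x
  ⊑complement⇒⋢ {a} atom-a (_ , _ , x∧c-greatest) a⊑c a⊑x =
    atom⋢𝟘 atom-a (x∧c-greatest a a⊑x a⊑c)

  complement≡𝟘⇒≡𝟙 : ∀ {x c} → IsJoin x c 𝟙 → c ≡ 𝟘 → x ≡ 𝟙
  complement≡𝟘⇒≡𝟙 {x} (_ , _ , x∨c-least) refl =
    ⊑-antisym x 𝟙 (𝟙-greatest x) (x∨c-least x (⊑-refl x) (𝟘-least x))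

  -- X = X ∧ (Y ∨ c) = (X ∧ Y) ∨ (X ∧ c) = (X ∧ Y) ∨ 0 ⊑ Y.
  disjoint-complement⇒⊑ : ∀ {X Y c} → IsJoin Y c 𝟙 → IsMeet X c 𝟘 → X ⊑ Y
  disjoint-complement⇒⊑ {X} {Y} {c} Y∨c X∧c
    with meet X Y | meet X 𝟙
  ... | m , X∧Y@(_ , m⊑Y , _) | m′ , X∧𝟙@(_ , _ , X∧𝟙-greatest)
    = ⊑-trans′ X⊑m′ (subst (_⊑ Y) (sym m′≡d) d⊑Y)
    where
    d : M
    d = proj₁ (join m 𝟘)
    m∨𝟘 : IsJoin m 𝟘 d
    m∨𝟘 = proj₂ (join m 𝟘)
    m′≡d : m′ ≡ d
    m′≡d = distrib X Y c 𝟙 m′ m 𝟘 d Y∨c X∧𝟙 X∧Y X∧c m∨𝟘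
    X⊑m′ : X ⊑ m′
    X⊑m′ = X∧𝟙-greatest X (⊑-refl X) (𝟙-greatest X)
    d⊑Y : d ⊑ Y
    d⊑Y = proj₂ (proj₂ m∨𝟘) Y m⊑Y (𝟘-least Y)

  -- Classically, X ∧ ¬Y is either 0, or it has an atom below it, which lies below X but not Y.
  atomistic : ExcludedMiddle 0ℓ →
              ∀ X Y → (∀ a → Atom a → a ⊑ X → a ⊑ Y) → X ⊑ Y
  atomistic em X Y atoms-X⊑Y with complemented Y
  ... | c , Y∧c , Y∨c with meet X c
  ... | m , X∧c@(m⊑X , m⊑c , _) with em {m ≡ 𝟘}
  ...   | yes refl = disjoint-complement⇒⊑ Y∨c X∧c
  ...   | no m≢𝟘 with atomic m m≢𝟘
  ...     | b , atom-b , b⊑m =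
    ⊥-elim (⊑complement⇒⋢ atom-b Y∧c (⊑-trans′ b⊑m m⊑c)
                          (atoms-X⊑Y b atom-b (⊑-trans′ b⊑m m⊑X)))

module AtomCoding {M : Set} {_⊑_ : M → M → Set} (𝓜 : IABA M _⊑_)
    (I : M → Set) (I-ideal : IABA.ProperIdeal 𝓜 I)
    (atoms⊆I : ∀ a → IABA.Atom 𝓜 a → I a)
    (f : M → M)
    (f-atom : ∀ x → I x → IABA.Atom 𝓜 (f x))
    (f-injective : ∀ x y → I x → I y → f x ≡ f y → x ≡ y)
    (f-onto-atoms : ∀ a → IABA.Atom 𝓜 a → Σ M (λ x → I x × (f x ≡ a))) where

  open IABA 𝓜
  open ProperIdeal I-ideal
  open AtomicBooleanAlgebra 𝓜

  _∈*_ : M → M → Set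
  x ∈* y = I x × (f x ⊑ y)

  open Classes I _∈*_

  ∉*𝟘 : ∀ w → I w → ¬ w ∈* 𝟘
  ∉*𝟘 w Iw (_ , fw⊑𝟘) = atom⋢𝟘 (f-atom w Iw) fw⊑𝟘

  ∈*-join : ∀ {X Y j} → IsJoin X Y j → ∀ w → I w → (w ∈* j ⇔ (w ∈* X ⊎ w ∈* Y))
  ∈*-join {X} {Y} {j} X∨Y@(X⊑j , Y⊑j , _) w Iw = mk⇔ to from
    where
    to : w ∈* j → w ∈* X ⊎ w ∈* Y
    to (_ , fw⊑j) with atom⊑join (f-atom w Iw) X∨Y fw⊑j
    ... | inj₁ fw⊑X = inj₁ (Iw , fw⊑X)
    ... | inj₂ fw⊑Y = inj₂ (Iw , fw⊑Y)
    from : w ∈* X ⊎ w ∈* Y → w ∈* j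
    from (inj₁ (_ , fw⊑X)) = Iw , ⊑-trans′ fw⊑X X⊑j
    from (inj₂ (_ , fw⊑Y)) = Iw , ⊑-trans′ fw⊑Y Y⊑j

  ∈*-meet : ∀ {X Y m} → IsMeet X Y m → ∀ w → I w → (w ∈* m ⇔ (w ∈* X × w ∈* Y))
  ∈*-meet (m⊑X , m⊑Y , m-greatest) w Iw = mk⇔
    (λ { (_ , fw⊑m) → (Iw , ⊑-trans′ fw⊑m m⊑X) , (Iw , ⊑-trans′ fw⊑m m⊑Y) })
    (λ { ((_ , fw⊑X) , (_ , fw⊑Y)) → Iw , m-greatest (f w) fw⊑X fw⊑Y })

  ∈*-complement : ∀ {X c} → IsMeet X c 𝟘 → IsJoin X c 𝟙 →
                  ∀ w → I w → (w ∈* c ⇔ (¬ w ∈* X))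
  ∈*-complement {X} {c} X∧c X∨c w Iw = mk⇔
    (λ { (_ , fw⊑c) (_ , fw⊑X) → ⊑complement⇒⋢ (f-atom w Iw) X∧c fw⊑c fw⊑X })
    from
    where
    from : ¬ w ∈* X → w ∈* c
    from w∉X with atom⊑⊎⊑complement (f-atom w Iw) X∨c
    ... | inj₁ fw⊑X = ⊥-elim (w∉X (Iw , fw⊑X))
    ... | inj₂ fw⊑c = Iw , fw⊑c

  ∈*-atom : ∀ {y} → I y → ∀ w → I w → (w ∈* f y ⇔ w ≡ y)
  ∈*-atom {y} Iy w Iw = mk⇔
    (λ { (_ , fw⊑fy) → f-injective w y Iw Iy (atom⊑atom⇒≡ (f-atom w Iw) (f-atom y Iy) fw⊑fy) })
    (λ { refl → Iw , ⊑-refl (f w) })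

  ⊆*⇒⊑ : ExcludedMiddle 0ℓ → ∀ {X Y} → X ⊆ Y → X ⊑ Y
  ⊆*⇒⊑ em {X} {Y} X⊆Y = atomistic em X Y λ a atom-a a⊑X →
    let (w , Iw , fw≡a) = f-onto-atoms a atom-a
    in subst (_⊑ Y) fw≡a (proj₂ (X⊆Y w Iw (Iw , subst (_⊑ X) (sym fw≡a) a⊑X)))

  ⊑⇒⊆* : ∀ {X Y} → X ⊑ Y → X ⊆ Y
  ⊑⇒⊆* X⊑Y w _ (Iw , fw⊑X) = Iw , ⊑-trans′ fw⊑X X⊑Y

  ⊆*⇔⊑ : ExcludedMiddle 0ℓ → ∀ X Y → X ⊆ Y ⇔ X ⊑ Y
  ⊆*⇔⊑ em X Y = mk⇔ (⊆*⇒⊑ em) ⊑⇒⊆*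

  set-outside : ∀ x → I x → Σ M (λ y → I y × ¬ y ∈* x)
  set-outside x Ix with complemented x
  ... | c , x∧c , x∨c with atomic c (λ c≡𝟘 → 𝟙∉I (subst I (complement≡𝟘⇒≡𝟙 x∨c c≡𝟘) Ix))
  ... | a , atom-a , a⊑c with f-onto-atoms a atom-a
  ... | w , Iw , refl =
    w , Iw , λ { (_ , fw⊑x) → ⊑complement⇒⋢ atom-a x∧c a⊑c fw⊑x }

  adjoin : ∀ x y → I x → I y →
           Σ M (λ z → I z × (∀ w → I w → (w ∈* z ⇔ (w ∈* x ⊎ w ≡ y))))
  adjoin x y Ix Iy with join x (f y)
  ... | z , x∨fy =
    z , join-closed x (f y) z Ix (atoms⊆I (f y) (f-atom y Iy)) x∨fy ,
    λ w Iw → (⇔-id _ ⊎-⇔ ∈*-atom Iy w Iw) ⇔-∘ ∈*-join x∨fy w Iw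

  ∈*-extensional : ExcludedMiddle 0ℓ → ∀ X Y → (∀ z → I z → (z ∈* X ⇔ z ∈* Y)) → X ≡ Y
  ∈*-extensional em X Y X≈Y = ⊑-antisym X Y
    (⊆*⇒⊑ em λ z Iz → Equivalence.to (X≈Y z Iz))
    (⊆*⇒⊑ em λ z Iz → Equivalence.from (X≈Y z Iz))

  bac : ExcludedMiddle 0ℓ → BAC
  bac em = record
    { Mem           = λ _ _ → proj₁
    ; Subset        = λ x X Ix X⊆x → down-closed x X (⊆*⇒⊑ em X⊆x) Ix
    ; Emp           = 𝟘 , 𝟘∈I , ∉*𝟘
    ; Adj           = adjoin
    ; CExt          = ∈*-extensional em
    ; Union         = λ x y Ix Iy → let (z , x∨y) = join x y in
                        z , join-closed x y z Ix Iy x∨y , ∈*-join x∨y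
    ; UB            = set-outside
    ; CUnion        = λ X Y → let (z , X∨Y) = join X Y in z , ∈*-join X∨Y
    ; CIntersection = λ X Y → let (z , X∧Y) = meet X Y in z , ∈*-meet X∧Y
    ; CComp         = λ X → let (c , X∧c , X∨c) = complemented X in
                        c , ∈*-complement X∧c X∨c
    }

mainTheorem10 : ExcludedMiddle 0ℓ →
    (M : Set) (_⊑_ : M → M → Set) (𝓜 : IABA M _⊑_) →
    (I : M → Set) → IABA.ProperIdeal 𝓜 I →
    (∀ a → IABA.Atom 𝓜 a → I a) →
    (f : M → M) →
    (∀ x → I x → IABA.Atom 𝓜 (f x)) →
    (∀ x y → I x → I y → f x ≡ f y → x ≡ y) →
    (∀ a → IABA.Atom 𝓜 a → Σ M (λ x → I x × (f x ≡ a))) →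
    Classes.BAC I (λ x y → I x × (f x ⊑ y))
      × (∀ x y → Classes._⊆_ I (λ x y → I x × (f x ⊑ y)) x y ⇔ (x ⊑ y))
mainTheorem10 em M _⊑_ 𝓜 I I-ideal atoms⊆I f f-atom f-injective f-onto-atoms =
  bac em , ⊆*⇔⊑ em
  where open AtomCoding 𝓜 I I-ideal atoms⊆I f f-atom f-injective f-onto-atoms
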